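{- Let $H=(V,E)$ be a hypergraph and let $B\subseteq V$ be a block of $H$. If Waiter has a winning strategy in the Client-Waiter game on $H$, then (in her winning strategy) she has to offer the vertices of $B$ two by two, i.e., she never offers a pair consisting of one vertex of $B$ and one vertex outside $B$.
   Context: A block of $H=(V,E)$ is a set $B\subseteq V$ with $|B|=2k$ for some integer $k\ge1$ such that every set of $k+1$ vertices of $B$ is an edge of $H$. Client-Waiter game on $H$: while at least two vertices are unclaimed, Waiter offers two unclaimed vertices, Client claims one and Waiter the other; if the number of vertices is odd the last vertex goes to Client. Client wins iff he claims all vertices of some edge; otherwise Waiter wins. -}

module Defs where

open import Data.Nat using (ℕ; suc; _<_; _≤_; _*_)
open import Data.Fin using (Fin)
open import Data.Fin.Subset using (Subset; _∈_; _∉_; _⊆_; _∪_; ∁; ⁅_⁆; ∣_∣; ⊥)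
open import Data.Product using (Σ; ∃; _×_)
open import Relation.Binary.PropositionalEquality using (_≡_; _≢_)
open import Relation.Nullary using (¬_)

record Hypergraph (n : ℕ) : Set₁ where
  field
    Edge : Subset n → Set
open Hypergraph public

IsBlock : ∀ {n} → Hypergraph n → Subset n → Set
IsBlock H B = Σ ℕ λ k → (1 ≤ k) × (∣ B ∣ ≡ 2 * k) ×
  (∀ S → S ⊆ B → ∣ S ∣ ≡ suc k → Edge H S)

-- Position of the game: C = vertices claimed by Client, W = claimed by Waiter.
-- Unclaimed vertices: ∁ (C ∪ W).
Free : ∀ {n} → Subset n → Subset n → Fin n → Set
Free C W v = v ∉ C × v ∉ W

ClientWins : ∀ {n} → Hypergraph n → Subset n → Set
ClientWins H C = ∃ λ e → Edge H e × e ⊆ C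

-- A winning strategy tree for Waiter from position (C , W).
--  * stop: fewer than two vertices are unclaimed, so the game ends; the
--    (at most one) remaining vertex goes to Client, and Client has not
--    claimed all vertices of an edge.
--  * offer u v: Waiter offers two distinct unclaimed vertices; for each
--    choice of Client a winning continuation is given.
data WaiterStrategy {n} (H : Hypergraph n) : Subset n → Subset n → Set where
  stop  : ∀ {C W} → ∣ ∁ (C ∪ W) ∣ < 2 →
          ¬ ClientWins H (C ∪ ∁ (C ∪ W)) → WaiterStrategy H C W
  offer : ∀ {C W} (u v : Fin n) → u ≢ v → Free C W u → Free C W v →
          WaiterStrategy H (C ∪ ⁅ u ⁆) (W ∪ ⁅ v ⁆) →
          WaiterStrategy H (C ∪ ⁅ v ⁆) (W ∪ ⁅ u ⁆) →
          WaiterStrategy H C W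

data Offered {n} {H : Hypergraph n} : ∀ {C W} → WaiterStrategy H C W → Fin n → Fin n → Set where
  here  : ∀ {C W u v p q r σ₁ σ₂} → Offered {C = C} {W} (offer u v p q r σ₁ σ₂) u v
  left  : ∀ {C W u v p q r σ₁ σ₂ x y} → Offered σ₁ x y →
          Offered {C = C} {W} (offer u v p q r σ₁ σ₂) x y
  right : ∀ {C W u v p q r σ₁ σ₂ x y} → Offered σ₂ x y →
          Offered {C = C} {W} (offer u v p q r σ₁ σ₂) x y

WaiterWinningStrategy : ∀ {n} → Hypergraph n → Set
WaiterWinningStrategy H = WaiterStrategy H ⊥ ⊥

{-# OPTIONS --safe #-}
module Submission where

-- Let |B| = 2k. Any k+1 vertices of B form an edge, so Client wins once he
-- ends with more than k vertices of B. If Client ever holds strictly more of B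
-- than Waiter, he stays ahead by taking a vertex of B whenever one is offered;
-- at the end he also owns every vertex Waiter does not, so he has more than k
-- vertices of B. From the start the counts in B are equal, and offers inside or
-- outside B keep them equal; a mixed offer at equal counts lets Client take the
-- vertex of B and get ahead.

open import Defs
open import Data.Nat using (ℕ)
open import Data.Fin using (Fin)
open import Data.Fin.Subset using (Subset; _∈_; _∉_)
open import Data.Product using (_×_)
open import Data.Sum using (_⊎_)
open import Relation.Nullary using (¬_)

open import Data.Nat using (zero; suc; _+_; _*_; _≤_; _<_; s≤s)
open import Data.Nat.Properties
  using (≤-reflexive; m≤n⇒m≤1+n; n<1+n; <-≤-trans; +-suc; +-identityʳ; +-monoˡ-<; +-monoʳ-≤;
         *-cancelˡ-<; module ≤-Reasoning)
open import Data.Fin using (zero; suc)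
open import Data.Fin.Subset using (_⊆_; _∪_; _∩_; ∁; ⁅_⁆; ∣_∣; ⊥; inside; outside)
open import Data.Fin.Subset.Properties
  using (_∈?_; x∈p∩q⁺; x∈p∩q⁻; x∈p∪q⁺; x∈p∪q⁻; p⊆p∪q; p∩q⊆p; p∩q⊆q;
         x∈∁p⇒x∉p; x∉p⇒x∈∁p; x∈⁅y⁆⇒x≡y; ∪-identityʳ; p⊆q⇒∣p∣≤∣q∣; ⊥⊆; ∣⊥∣≡0; s⊆s; out⊆)
open import Data.Vec using ([]; _∷_; here; there)
open import Data.Product using (Σ; _,_)
open import Data.Sum using (inj₁; inj₂; [_,_])
open import Function using (_∘_; id)
open import Relation.Binary.PropositionalEquality using (_≡_; refl; sym; trans; cong; subst; module ≡-Reasoning)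
open import Relation.Nullary using (Dec; yes; no; ¬?; contradiction)
open import Relation.Nullary.Decidable using (_×-dec_; _⊎-dec_)

private
  variable
    n : ℕ
    x : Fin n
    p q r : Subset n

∩-monoʳ-⊆ : q ⊆ r → p ∩ q ⊆ p ∩ r
∩-monoʳ-⊆ {q = q} {p = p} q⊆r x∈p∩q with x∈p∩q⁻ p q x∈p∩q
... | x∈p , x∈q = x∈p∩q⁺ (x∈p , q⊆r x∈q)

∣p∩q∣≤∣p∩r∣ : ∀ (p : Subset n) → q ⊆ r → ∣ p ∩ q ∣ ≤ ∣ p ∩ r ∣
∣p∩q∣≤∣p∩r∣ p q⊆r = p⊆q⇒∣p∣≤∣q∣ (∩-monoʳ-⊆ {p = p} q⊆r)

∁q⊆p∪∁[p∪q] : ∀ (p q : Subset n) → ∁ q ⊆ p ∪ ∁ (p ∪ q)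
∁q⊆p∪∁[p∪q] p q {x} x∈∁q with x ∈? p
... | yes x∈p = x∈p∪q⁺ (inj₁ x∈p)
... | no  x∉p = x∈p∪q⁺ (inj₂ (x∉p⇒x∈∁p ([ x∉p , x∈∁p⇒x∉p x∈∁q ] ∘ x∈p∪q⁻ p q)))

∣p∩[q∪⁅x⁆]∣≡1+∣p∩q∣ : x ∈ p → x ∉ q → ∣ p ∩ (q ∪ ⁅ x ⁆) ∣ ≡ suc ∣ p ∩ q ∣
∣p∩[q∪⁅x⁆]∣≡1+∣p∩q∣ {q = inside ∷ q} here x∉q = contradiction here x∉q
∣p∩[q∪⁅x⁆]∣≡1+∣p∩q∣ {p = _ ∷ p} {outside ∷ q} here x∉q = cong (suc ∘ ∣_∣ ∘ (p ∩_)) (∪-identityʳ q)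
∣p∩[q∪⁅x⁆]∣≡1+∣p∩q∣ {p = inside ∷ p} {inside ∷ q} (there x∈p) x∉q =
  cong suc (∣p∩[q∪⁅x⁆]∣≡1+∣p∩q∣ x∈p (x∉q ∘ there))
∣p∩[q∪⁅x⁆]∣≡1+∣p∩q∣ {p = inside ∷ p} {outside ∷ q} (there x∈p) x∉q =
  ∣p∩[q∪⁅x⁆]∣≡1+∣p∩q∣ x∈p (x∉q ∘ there)
∣p∩[q∪⁅x⁆]∣≡1+∣p∩q∣ {p = outside ∷ p} {_ ∷ q} (there x∈p) x∉q =
  ∣p∩[q∪⁅x⁆]∣≡1+∣p∩q∣ x∈p (x∉q ∘ there)

∣p∩[q∪⁅x⁆]∣≡∣p∩q∣ : x ∉ p → ∣ p ∩ (q ∪ ⁅ x ⁆) ∣ ≡ ∣ p ∩ q ∣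
∣p∩[q∪⁅x⁆]∣≡∣p∩q∣ {x = zero} {inside ∷ p} x∉p = contradiction here x∉p
∣p∩[q∪⁅x⁆]∣≡∣p∩q∣ {x = zero} {outside ∷ p} {_ ∷ q} _ = cong (∣_∣ ∘ (p ∩_)) (∪-identityʳ q)
∣p∩[q∪⁅x⁆]∣≡∣p∩q∣ {x = suc x} {inside ∷ p} {inside ∷ q} x∉p =
  cong suc (∣p∩[q∪⁅x⁆]∣≡∣p∩q∣ (x∉p ∘ there))
∣p∩[q∪⁅x⁆]∣≡∣p∩q∣ {x = suc x} {inside ∷ p} {outside ∷ q} x∉p = ∣p∩[q∪⁅x⁆]∣≡∣p∩q∣ (x∉p ∘ there)
∣p∩[q∪⁅x⁆]∣≡∣p∩q∣ {x = suc x} {outside ∷ p} {_ ∷ q} x∉p = ∣p∩[q∪⁅x⁆]∣≡∣p∩q∣ (x∉p ∘ there)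

∣p∩[q∪⁅x⁆]∣≤1+∣p∩q∣ : ∀ (p q : Subset n) x → ∣ p ∩ (q ∪ ⁅ x ⁆) ∣ ≤ suc ∣ p ∩ q ∣
∣p∩[q∪⁅x⁆]∣≤1+∣p∩q∣ p q x with x ∈? p | x ∈? q
... | no x∉p  | _       = m≤n⇒m≤1+n (≤-reflexive (∣p∩[q∪⁅x⁆]∣≡∣p∩q∣ x∉p))
... | yes x∈p | no x∉q  = ≤-reflexive (∣p∩[q∪⁅x⁆]∣≡1+∣p∩q∣ x∈p x∉q)
... | yes _   | yes x∈q = m≤n⇒m≤1+n (∣p∩q∣≤∣p∩r∣ p q∪⁅x⁆⊆q)
  where
  q∪⁅x⁆⊆q : q ∪ ⁅ x ⁆ ⊆ q
  q∪⁅x⁆⊆q y∈q∪⁅x⁆ = [ id , (λ y∈⁅x⁆ → subst (_∈ q) (sym (x∈⁅y⁆⇒x≡y x y∈⁅x⁆)) x∈q) ]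
                       (x∈p∪q⁻ q ⁅ x ⁆ y∈q∪⁅x⁆)

∣p∩q∣+∣p∩∁q∣≡∣p∣ : ∀ (p q : Subset n) → ∣ p ∩ q ∣ + ∣ p ∩ ∁ q ∣ ≡ ∣ p ∣
∣p∩q∣+∣p∩∁q∣≡∣p∣ []            []            = refl
∣p∩q∣+∣p∩∁q∣≡∣p∣ (inside  ∷ p) (inside  ∷ q) = cong suc (∣p∩q∣+∣p∩∁q∣≡∣p∣ p q)
∣p∩q∣+∣p∩∁q∣≡∣p∣ (inside  ∷ p) (outside ∷ q) =
  trans (+-suc ∣ p ∩ q ∣ _) (cong suc (∣p∩q∣+∣p∩∁q∣≡∣p∣ p q))
∣p∩q∣+∣p∩∁q∣≡∣p∣ (outside ∷ p) (_       ∷ q) = ∣p∩q∣+∣p∩∁q∣≡∣p∣ p q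

subset-of-size : ∀ {m} (p : Subset n) → m ≤ ∣ p ∣ → Σ (Subset n) λ q → q ⊆ p × ∣ q ∣ ≡ m
subset-of-size {n} {zero} p _ = ⊥ , ⊥⊆ , ∣⊥∣≡0 n
subset-of-size {m = suc m} (inside ∷ p) (s≤s m≤∣p∣) with subset-of-size p m≤∣p∣
... | q , q⊆p , ∣q∣≡m = inside ∷ q , s⊆s q⊆p , cong suc ∣q∣≡m
subset-of-size {m = suc m} (outside ∷ p) m<∣p∣ with subset-of-size p m<∣p∣
... | q , q⊆p , ∣q∣≡m = outside ∷ q , out⊆ q⊆p , ∣q∣≡m

m<n⇒2*o≤m+n⇒o<n : ∀ {m n} o → m < n → 2 * o ≤ m + n → o < n
m<n⇒2*o≤m+n⇒o<n {m} {n} o m<n 2o≤m+n = *-cancelˡ-< 2 o n (begin-strict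
  2 * o   ≤⟨ 2o≤m+n ⟩
  m + n   <⟨ +-monoˡ-< n m<n ⟩
  n + n   ≡⟨ cong (n +_) (sym (+-identityʳ n)) ⟩
  2 * n   ∎)
  where open ≤-Reasoning

module Block {n} (H : Hypergraph n) (B : Subset n) (k : ℕ) (∣B∣≡2k : ∣ B ∣ ≡ 2 * k)
             (edges : ∀ S → S ⊆ B → ∣ S ∣ ≡ suc k → Edge H S) where

  Ahead : Subset n → Subset n → Set
  Ahead C W = ∣ B ∩ W ∣ < ∣ B ∩ C ∣

  Balanced : Subset n → Subset n → Set
  Balanced C W = ∣ B ∩ C ∣ ≡ ∣ B ∩ W ∣

  Mixed : Fin n → Fin n → Set
  Mixed u v = (u ∈ B × v ∉ B) ⊎ (u ∉ B × v ∈ B)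

  mixed? : ∀ u v → Dec (Mixed u v)
  mixed? u v = (u ∈? B ×-dec ¬? (v ∈? B)) ⊎-dec (¬? (u ∈? B) ×-dec v ∈? B)

  mixed-sym : ∀ {u v} → Mixed u v → Mixed v u
  mixed-sym (inj₁ (u∈B , v∉B)) = inj₂ (v∉B , u∈B)
  mixed-sym (inj₂ (u∉B , v∈B)) = inj₁ (v∈B , u∉B)

  majority⇒ClientWins : ∀ {X} → k < ∣ B ∩ X ∣ → ClientWins H X
  majority⇒ClientWins {X} k<∣B∩X∣ with subset-of-size (B ∩ X) k<∣B∩X∣
  ... | S , S⊆B∩X , ∣S∣≡1+k = S , edges S (p∩q⊆p B X ∘ S⊆B∩X) ∣S∣≡1+k , p∩q⊆q B X ∘ S⊆B∩X

  ahead⇒final-majority : ∀ {C W} → Ahead C W → k < ∣ B ∩ (C ∪ ∁ (C ∪ W)) ∣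
  ahead⇒final-majority {C} {W} ahead =
    m<n⇒2*o≤m+n⇒o<n k (<-≤-trans ahead (∣p∩q∣≤∣p∩r∣ B (p⊆p∪q _))) (begin
      2 * k                              ≡⟨ sym ∣B∣≡2k ⟩
      ∣ B ∣                              ≡⟨ sym (∣p∩q∣+∣p∩∁q∣≡∣p∣ B W) ⟩
      ∣ B ∩ W ∣ + ∣ B ∩ ∁ W ∣            ≤⟨ +-monoʳ-≤ ∣ B ∩ W ∣ (∣p∩q∣≤∣p∩r∣ B (∁q⊆p∪∁[p∪q] C W)) ⟩
      ∣ B ∩ W ∣ + ∣ B ∩ (C ∪ ∁ (C ∪ W)) ∣ ∎)
    where open ≤-Reasoning

  ahead⇒¬WaiterStrategy : ∀ {C W} → Ahead C W → ¬ WaiterStrategy H C W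
  ahead⇒¬WaiterStrategy ahead (stop _ ¬clientWins) =
    ¬clientWins (majority⇒ClientWins (ahead⇒final-majority ahead))
  ahead⇒¬WaiterStrategy {C} {W} ahead (offer u v _ (u∉C , _) _ σ₁ σ₂) with u ∈? B
  ... | yes u∈B = ahead⇒¬WaiterStrategy (begin-strict
    ∣ B ∩ (W ∪ ⁅ v ⁆) ∣ ≤⟨ ∣p∩[q∪⁅x⁆]∣≤1+∣p∩q∣ B W v ⟩
    suc ∣ B ∩ W ∣       <⟨ s≤s ahead ⟩
    suc ∣ B ∩ C ∣       ≡⟨ sym (∣p∩[q∪⁅x⁆]∣≡1+∣p∩q∣ u∈B u∉C) ⟩
    ∣ B ∩ (C ∪ ⁅ u ⁆) ∣ ∎) σ₁
    where open ≤-Reasoning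
  ... | no u∉B = ahead⇒¬WaiterStrategy (begin-strict
    ∣ B ∩ (W ∪ ⁅ u ⁆) ∣ ≡⟨ ∣p∩[q∪⁅x⁆]∣≡∣p∩q∣ u∉B ⟩
    ∣ B ∩ W ∣           <⟨ ahead ⟩
    ∣ B ∩ C ∣           ≤⟨ ∣p∩q∣≤∣p∩r∣ B (p⊆p∪q _) ⟩
    ∣ B ∩ (C ∪ ⁅ v ⁆) ∣ ∎) σ₂
    where open ≤-Reasoning

  balanced⇒take-block-vertex-ahead : ∀ {C W x y} → Balanced C W → x ∈ B → x ∉ C → y ∉ B →
                                     Ahead (C ∪ ⁅ x ⁆) (W ∪ ⁅ y ⁆)
  balanced⇒take-block-vertex-ahead {C} {W} {x} {y} balanced x∈B x∉C y∉B = begin-strict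
    ∣ B ∩ (W ∪ ⁅ y ⁆) ∣ ≡⟨ ∣p∩[q∪⁅x⁆]∣≡∣p∩q∣ y∉B ⟩
    ∣ B ∩ W ∣           ≡⟨ sym balanced ⟩
    ∣ B ∩ C ∣           <⟨ n<1+n _ ⟩
    suc ∣ B ∩ C ∣       ≡⟨ sym (∣p∩[q∪⁅x⁆]∣≡1+∣p∩q∣ x∈B x∉C) ⟩
    ∣ B ∩ (C ∪ ⁅ x ⁆) ∣ ∎
    where open ≤-Reasoning

  balanced-unmixed-step : ∀ {C W u v} → Balanced C W → Free C W u → Free C W v → ¬ Mixed u v →
                          Balanced (C ∪ ⁅ u ⁆) (W ∪ ⁅ v ⁆)
  balanced-unmixed-step {C} {W} {u} {v} balanced (u∉C , _) (_ , v∉W) ¬mixed with u ∈? B | v ∈? B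
  ... | yes u∈B | yes v∈B = begin
    ∣ B ∩ (C ∪ ⁅ u ⁆) ∣ ≡⟨ ∣p∩[q∪⁅x⁆]∣≡1+∣p∩q∣ u∈B u∉C ⟩
    suc ∣ B ∩ C ∣       ≡⟨ cong suc balanced ⟩
    suc ∣ B ∩ W ∣       ≡⟨ sym (∣p∩[q∪⁅x⁆]∣≡1+∣p∩q∣ v∈B v∉W) ⟩
    ∣ B ∩ (W ∪ ⁅ v ⁆) ∣ ∎
    where open ≡-Reasoning
  ... | no u∉B  | no v∉B  = begin
    ∣ B ∩ (C ∪ ⁅ u ⁆) ∣ ≡⟨ ∣p∩[q∪⁅x⁆]∣≡∣p∩q∣ u∉B ⟩
    ∣ B ∩ C ∣           ≡⟨ balanced ⟩
    ∣ B ∩ W ∣           ≡⟨ sym (∣p∩[q∪⁅x⁆]∣≡∣p∩q∣ v∉B) ⟩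
    ∣ B ∩ (W ∪ ⁅ v ⁆) ∣ ∎
    where open ≡-Reasoning
  ... | yes u∈B | no v∉B  = contradiction (inj₁ (u∈B , v∉B)) ¬mixed
  ... | no u∉B  | yes v∈B = contradiction (inj₂ (u∉B , v∈B)) ¬mixed

  balanced⇒offer-unmixed : ∀ {C W u v} → Balanced C W → Free C W u → Free C W v →
                           WaiterStrategy H (C ∪ ⁅ u ⁆) (W ∪ ⁅ v ⁆) →
                           WaiterStrategy H (C ∪ ⁅ v ⁆) (W ∪ ⁅ u ⁆) → ¬ Mixed u v
  balanced⇒offer-unmixed balanced (u∉C , _) _ σ₁ _ (inj₁ (u∈B , v∉B)) =
    ahead⇒¬WaiterStrategy (balanced⇒take-block-vertex-ahead balanced u∈B u∉C v∉B) σ₁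
  balanced⇒offer-unmixed balanced _ (v∉C , _) _ σ₂ (inj₂ (u∉B , v∈B)) =
    ahead⇒¬WaiterStrategy (balanced⇒take-block-vertex-ahead balanced v∈B v∉C u∉B) σ₂

  balanced⇒offered-unmixed : ∀ {C W} {σ : WaiterStrategy H C W} {x y} →
                             Balanced C W → Offered σ x y → ¬ Mixed x y
  balanced⇒offered-unmixed {σ = offer u v _ free-u free-v σ₁ σ₂} balanced here =
    balanced⇒offer-unmixed balanced free-u free-v σ₁ σ₂
  balanced⇒offered-unmixed {σ = offer u v _ free-u free-v σ₁ σ₂} balanced (left offered)
    with mixed? u v
  ... | yes mixed = contradiction mixed (balanced⇒offer-unmixed balanced free-u free-v σ₁ σ₂)
  ... | no ¬mixed =
    balanced⇒offered-unmixed (balanced-unmixed-step balanced free-u free-v ¬mixed) offered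
  balanced⇒offered-unmixed {σ = offer u v _ free-u free-v σ₁ σ₂} balanced (right offered)
    with mixed? u v
  ... | yes mixed = contradiction mixed (balanced⇒offer-unmixed balanced free-u free-v σ₁ σ₂)
  ... | no ¬mixed =
    balanced⇒offered-unmixed (balanced-unmixed-step balanced free-v free-u (¬mixed ∘ mixed-sym)) offered

mainTheorem8 : ∀ {n} (H : Hypergraph n) (B : Subset n) → IsBlock H B →
    (σ : WaiterWinningStrategy H) → ∀ u v → Offered σ u v →
    ¬ ((u ∈ B × v ∉ B) ⊎ (u ∉ B × v ∈ B))
mainTheorem8 H B (k , _ , ∣B∣≡2k , edges) σ u v offered =
  Block.balanced⇒offered-unmixed H B k ∣B∣≡2k edges refl offered
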